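{- Let $\mathbb K$ be a field of characteristic $0$ and $G=\vec{C}_5^{1,2}$. Then \[H_n^{\mathrm{path}}(G;\mathbb K)\cong\begin{cases}\mathbb K & n=0,1,\\ 0 & n\geq 2.\end{cases}\]
   Context: GLMY path complex: for a finite digraph $G=(V,E)$ without loops, elementary $n$-paths $e_{v_0\cdots v_n}$ span $\Lambda_n$ with boundary $\partial e_{v_0\cdots v_n}=\sum_{j=0}^n(-1)^j e_{v_0\cdots\widehat{v_j}\cdots v_n}$; paths with two equal consecutive vertices are set to zero (regular paths). $A_n(G;\mathbb K)$ is the span of regular elementary paths all of whose consecutive pairs are arrows. $\Omega_0=A_0$, $\Omega_1=A_1$, $\Omega_n=\{u\in A_n:\partial u\in A_{n-1}\}$ for $n\ge2$; $H_n^{\mathrm{path}}(G;\mathbb K)=H_n(\Omega_*(G;\mathbb K),\partial)$. The circulant digraph $\vec{C}_5^{1,2}$ has vertex set $\mathbb Z_5$ and arrows $a\to a+1$, $a\to a+2$ (mod $5$). -}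

module Defs where

open import Level using (Level; _⊔_) renaming (suc to lsuc)
open import Algebra.Bundles using (CommutativeRing)
open import Data.Nat using (ℕ; zero; suc)
open import Data.Fin using (Fin; toℕ) renaming (zero to fz; suc to fs)
open import Data.Fin.Properties using (_≟_)
open import Data.Vec using (Vec; []; _∷_; insertAt)
open import Data.Bool using (Bool; true; false; if_then_else_; _∧_)
open import Data.Product using (Σ; _×_; _,_; proj₁)
open import Data.Sum using (_⊎_)
open import Data.Unit using (⊤)
open import Relation.Nullary using (¬_; does)
open import Relation.Binary.PropositionalEquality using (_≡_)

record Field (c ℓ : Level) : Set (lsuc (c ⊔ ℓ)) where
  field
    commutativeRing : CommutativeRing c ℓ
  open CommutativeRing commutativeRing public
  field
    0≉1     : ¬ (0# ≈ 1#)
    inverse : ∀ x → ¬ (x ≈ 0#) → Σ Carrier (λ y → (x * y) ≈ 1#)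

module _ {c ℓ} (F : Field c ℓ) where
  open Field F using (Carrier; _≈_; _+_; _*_; -_; _-_; 0#; 1#)

  natCast : ℕ → Carrier
  natCast zero    = 0#
  natCast (suc n) = 1# + natCast n

  CharZero : Set ℓ
  CharZero = ∀ n → ¬ (natCast (suc n) ≈ 0#)

-- A chain of degree n is a function assigning a coefficient to every
-- sequence of n+1 vertices (an elementary n-path).

module PathHomology {c ℓ} (F : Field c ℓ) (m : ℕ) (Arr : Fin m → Fin m → Set) where
  open Field F using (Carrier; _≈_; _+_; _*_; -_; _-_; 0#; 1#)

  Path : ℕ → Set
  Path k = Vec (Fin m) k

  Chain : ℕ → Set c
  Chain n = Path (suc n) → Carrier

  Allowed : ∀ {k} → Path k → Set
  Allowed []           = ⊤
  Allowed (x ∷ [])     = ⊤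
  Allowed (x ∷ y ∷ xs) = Arr x y × Allowed (y ∷ xs)

  regular? : ∀ {k} → Path k → Bool
  regular? []           = true
  regular? (x ∷ [])     = true
  regular? (x ∷ y ∷ xs) = (if does (x ≟ y) then false else true) ∧ regular? (y ∷ xs)

  sumFin : ∀ {k} → (Fin k → Carrier) → Carrier
  sumFin {zero}  f = 0#
  sumFin {suc k} f = f fz + sumFin (λ i → f (fs i))

  sign : ℕ → Carrier → Carrier
  sign zero          x = x
  sign (suc zero)    x = - x
  sign (suc (suc j)) x = sign j x

  -- boundary on regular paths: the coefficient of a regular path q in ∂u is
  -- Σ_j (-1)^j Σ_v u(q with v inserted at position j); non-regular paths are 0.
  ∂ : ∀ n → Chain (suc n) → Chain n
  ∂ n u q = if regular? q
              then sumFin (λ j → sign (toℕ j) (sumFin (λ v → u (insertAt q j v))))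
              else 0#

  InA : ∀ n → Chain n → Set ℓ
  InA n u = ∀ p → ¬ Allowed p → u p ≈ 0#

  InΩ : ∀ n → Chain n → Set ℓ
  InΩ zero    u = InA zero u
  InΩ (suc n) u = InA (suc n) u × InA n (∂ n u)

  -- cycles of Ω_* (∂ on Ω_0 is zero)
  IsCycle : ∀ n → Chain n → Set ℓ
  IsCycle zero    u = InΩ zero u × ⊤
  IsCycle (suc n) u = InΩ (suc n) u × (∀ q → ∂ n u q ≈ 0#)

  Cycle : ℕ → Set (c ⊔ ℓ)
  Cycle n = Σ (Chain n) (IsCycle n)

  Homologous : ∀ n → Chain n → Chain n → Set (c ⊔ ℓ)
  Homologous n u w = Σ (Chain (suc n)) λ b → InΩ (suc n) b × (∀ p → ∂ n b p ≈ (u p - w p))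

  -- H_n = Cycle n / Homologous (as a setoid) is isomorphic to K as a K-vector space:
  -- a K-linear map H_n → K with a two-sided inverse, both well defined on classes.
  record HomologyIsoK (n : ℕ) : Set (c ⊔ ℓ) where
    field
      to        : Cycle n → Carrier
      from      : Carrier → Cycle n
      to-cong   : ∀ (z w : Cycle n) → Homologous n (proj₁ z) (proj₁ w) → to z ≈ to w
      from-cong : ∀ x y → x ≈ y → Homologous n (proj₁ (from x)) (proj₁ (from y))
      to-+      : ∀ (z w s : Cycle n) → (∀ p → proj₁ s p ≈ (proj₁ z p + proj₁ w p)) →
                  to s ≈ (to z + to w)
      to-*      : ∀ (a : Carrier) (z s : Cycle n) → (∀ p → proj₁ s p ≈ (a * proj₁ z p)) →
                  to s ≈ (a * to z)
      to-from   : ∀ x → to (from x) ≈ x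
      from-to   : ∀ (z : Cycle n) → Homologous n (proj₁ (from (to z))) (proj₁ z)

  HomologyTrivial : ℕ → Set (c ⊔ ℓ)
  HomologyTrivial n = ∀ (z : Cycle n) → Homologous n (proj₁ z) (λ _ → 0#)

succ5 : Fin 5 → Fin 5
succ5 fz                          = fs fz
succ5 (fs fz)                     = fs (fs fz)
succ5 (fs (fs fz))                = fs (fs (fs fz))
succ5 (fs (fs (fs fz)))           = fs (fs (fs (fs fz)))
succ5 (fs (fs (fs (fs fz))))      = fz

ArrC5 : Fin 5 → Fin 5 → Set
ArrC5 a b = (b ≡ succ5 a) ⊎ (b ≡ succ5 (succ5 a))

-- Ω_n of C₅^{1,2} has a basis indexed by two copies of ℤ/5: α_x, the path of n steps +1 from x,
-- and β_x, the alternating sum of the paths from x with exactly one +2 step.  Because the graph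
-- has no 2-cycles and x → x+3, x → x+4 are not arrows, every Ω-chain is ω a b = Σ a_x α_x + b_x β_x,
-- and ∂ acts on the coefficient pair (a, b) by an explicit circulant formula (∂α, ∂β).
-- In degree ≥ 2 a cycle has ∂β = 0 and is then the boundary of ω (-b) 0.  In degree 0 the total
-- coefficient, and in degree 1 the winding number (1/5 per +1 arrow, 2/5 per +2 arrow; this needs
-- 5 ≠ 0 in K) vanish on boundaries and equal 1 on a spanning cycle, which identifies H₀ and H₁ with K.

module Submission where

open import Defs
open import Data.Nat using (ℕ; _≤_)
open import Data.Product using (_×_)

open import Algebra.Bundles using (CommutativeRing)
open import Algebra.Solver.Ring.AlmostCommutativeRing using (fromCommutativeRing; _-Raw-AlmostCommutative⟶_)
open import Data.Nat.Base as ℕ using (zero; suc)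
import Data.Nat.Properties as ℕ
open import Data.Integer.Base as ℤ using (ℤ; +_; -[1+_])
import Data.Integer.Properties as ℤ
open import Data.Sign.Base as Sign using (Sign)
open import Data.Maybe.Base using (Maybe; just; nothing)
open import Data.Fin.Base using (Fin; toℕ; inject₁; fromℕ) renaming (zero to fz; suc to fs)
open import Data.Fin.Properties using (_≟_; all?)
open import Data.Vec.Base using ([]; _∷_; insertAt)
open import Data.Bool.Base using (true; false; if_then_else_)
open import Data.Product.Base using (_,_; proj₁; proj₂)
open import Data.Sum.Base using (inj₁; inj₂; [_,_]′)
open import Data.Unit.Base using (tt)
open import Function.Base using (case_of_)
open import Level using (_⊔_)
open import Relation.Nullary using (¬_; Dec; does; yes; no; contradiction)
open import Relation.Nullary.Decidable using (from-yes; ¬?; _⊎-dec_; _×-dec_; _→-dec_)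
open import Relation.Binary.PropositionalEquality as ≡ using (_≡_; _≢_; ≢-sym)

module IntegerCoefficientSolver {c ℓ} (R : CommutativeRing c ℓ) where
  open CommutativeRing R
  open import Algebra.Properties.Ring ring using (-‿distribˡ-*; -‿distribʳ-*; -‿involutive; -0#≈0#; -‿anti-homo-+)
  open import Relation.Binary.Reasoning.Setoid setoid

  -- 1 goes to 1# itself (not 1# + 0#), so that the solver's constant 1 is literally 1#
  ℕ↦R : ℕ → Carrier
  ℕ↦R zero = 0#
  ℕ↦R (suc zero) = 1#
  ℕ↦R (suc (suc n)) = 1# + ℕ↦R (suc n)

  ℕ↦R-suc : ∀ n → ℕ↦R (suc n) ≈ 1# + ℕ↦R n
  ℕ↦R-suc zero = sym (+-identityʳ 1#)
  ℕ↦R-suc (suc n) = refl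

  ℕ↦R-+ : ∀ m n → ℕ↦R (m ℕ.+ n) ≈ ℕ↦R m + ℕ↦R n
  ℕ↦R-+ zero n = sym (+-identityˡ _)
  ℕ↦R-+ (suc m) n = begin
    ℕ↦R (suc (m ℕ.+ n))      ≈⟨ ℕ↦R-suc (m ℕ.+ n) ⟩
    1# + ℕ↦R (m ℕ.+ n)       ≈⟨ +-congˡ (ℕ↦R-+ m n) ⟩
    1# + (ℕ↦R m + ℕ↦R n)     ≈⟨ +-assoc _ _ _ ⟨
    (1# + ℕ↦R m) + ℕ↦R n     ≈⟨ +-congʳ (ℕ↦R-suc m) ⟨
    ℕ↦R (suc m) + ℕ↦R n      ∎

  ℕ↦R-* : ∀ m n → ℕ↦R (m ℕ.* n) ≈ ℕ↦R m * ℕ↦R n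
  ℕ↦R-* zero n = sym (zeroˡ _)
  ℕ↦R-* (suc m) n = begin
    ℕ↦R (n ℕ.+ m ℕ.* n)          ≈⟨ ℕ↦R-+ n (m ℕ.* n) ⟩
    ℕ↦R n + ℕ↦R (m ℕ.* n)        ≈⟨ +-cong (sym (*-identityˡ _)) (ℕ↦R-* m n) ⟩
    1# * ℕ↦R n + ℕ↦R m * ℕ↦R n   ≈⟨ distribʳ _ _ _ ⟨
    (1# + ℕ↦R m) * ℕ↦R n         ≈⟨ *-congʳ (ℕ↦R-suc m) ⟨
    ℕ↦R (suc m) * ℕ↦R n          ∎

  ℤ↦R : ℤ → Carrier
  ℤ↦R (+ n) = ℕ↦R n
  ℤ↦R -[1+ n ] = - ℕ↦R (suc n)

  private
    cancel-1# : ∀ a b → (1# + a) - (1# + b) ≈ a - b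
    cancel-1# a b = begin
      (1# + a) + - (1# + b)      ≈⟨ +-congˡ (-‿anti-homo-+ 1# b) ⟩
      (1# + a) + (- b + - 1#)    ≈⟨ +-congʳ (+-comm 1# a) ⟩
      (a + 1#) + (- b + - 1#)    ≈⟨ +-assoc a 1# _ ⟩
      a + (1# + (- b + - 1#))    ≈⟨ +-congˡ (+-congˡ (+-comm (- b) (- 1#))) ⟩
      a + (1# + (- 1# + - b))    ≈⟨ +-congˡ (+-assoc 1# (- 1#) (- b)) ⟨
      a + ((1# + - 1#) + - b)    ≈⟨ +-congˡ (+-congʳ (-‿inverseʳ 1#)) ⟩
      a + (0# + - b)             ≈⟨ +-congˡ (+-identityˡ (- b)) ⟩
      a - b                      ∎

  ℤ↦R-⊖ : ∀ m n → ℤ↦R (m ℤ.⊖ n) ≈ ℕ↦R m - ℕ↦R n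
  ℤ↦R-⊖ zero zero = sym (-‿inverseʳ 0#)
  ℤ↦R-⊖ (suc m) zero = sym (trans (+-congˡ -0#≈0#) (+-identityʳ _))
  ℤ↦R-⊖ zero (suc n) = sym (+-identityˡ _)
  ℤ↦R-⊖ (suc m) (suc n) = begin
    ℤ↦R (suc m ℤ.⊖ suc n)          ≡⟨ ≡.cong ℤ↦R (ℤ.[1+m]⊖[1+n]≡m⊖n m n) ⟩
    ℤ↦R (m ℤ.⊖ n)                  ≈⟨ ℤ↦R-⊖ m n ⟩
    ℕ↦R m - ℕ↦R n                  ≈⟨ cancel-1# (ℕ↦R m) (ℕ↦R n) ⟨
    (1# + ℕ↦R m) - (1# + ℕ↦R n)    ≈⟨ +-cong (ℕ↦R-suc m) (-‿cong (ℕ↦R-suc n)) ⟨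
    ℕ↦R (suc m) - ℕ↦R (suc n)      ∎

  ℤ↦R-+ : ∀ i j → ℤ↦R (i ℤ.+ j) ≈ ℤ↦R i + ℤ↦R j
  ℤ↦R-+ -[1+ m ] -[1+ n ] = begin
    - ℕ↦R (suc (suc (m ℕ.+ n)))          ≡⟨ ≡.cong (λ k → - ℕ↦R (suc k)) (ℕ.+-suc m n) ⟨
    - ℕ↦R (suc m ℕ.+ suc n)              ≈⟨ -‿cong (ℕ↦R-+ (suc m) (suc n)) ⟩
    - (ℕ↦R (suc m) + ℕ↦R (suc n))        ≈⟨ -‿anti-homo-+ _ _ ⟩
    - ℕ↦R (suc n) + - ℕ↦R (suc m)        ≈⟨ +-comm _ _ ⟩
    - ℕ↦R (suc m) + - ℕ↦R (suc n)        ∎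
  ℤ↦R-+ -[1+ m ] (+ n) = trans (ℤ↦R-⊖ n (suc m)) (+-comm _ _)
  ℤ↦R-+ (+ m) -[1+ n ] = ℤ↦R-⊖ m (suc n)
  ℤ↦R-+ (+ m) (+ n) = ℕ↦R-+ m n

  ℤ↦R-neg : ∀ i → ℤ↦R (ℤ.- i) ≈ - ℤ↦R i
  ℤ↦R-neg -[1+ n ] = sym (-‿involutive _)
  ℤ↦R-neg (+ zero) = sym -0#≈0#
  ℤ↦R-neg (+ suc n) = refl

  private
    signed : Sign → Carrier → Carrier
    signed Sign.+ x = x
    signed Sign.- x = - x

    signed-cong : ∀ s {x y} → x ≈ y → signed s x ≈ signed s y
    signed-cong Sign.+ p = p
    signed-cong Sign.- p = -‿cong p

    signed-* : ∀ s t x y → signed (s Sign.* t) (x * y) ≈ signed s x * signed t y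
    signed-* Sign.+ Sign.+ x y = refl
    signed-* Sign.+ Sign.- x y = -‿distribʳ-* x y
    signed-* Sign.- Sign.+ x y = -‿distribˡ-* x y
    signed-* Sign.- Sign.- x y = begin
      x * y          ≈⟨ -‿involutive _ ⟨
      - - (x * y)    ≈⟨ -‿cong (-‿distribʳ-* x y) ⟩
      - (x * - y)    ≈⟨ -‿distribˡ-* x (- y) ⟩
      - x * - y      ∎

    ℤ↦R-◃ : ∀ s n → ℤ↦R (s ℤ.◃ n) ≈ signed s (ℕ↦R n)
    ℤ↦R-◃ Sign.+ zero = refl
    ℤ↦R-◃ Sign.- zero = sym -0#≈0#
    ℤ↦R-◃ Sign.+ (suc n) = refl
    ℤ↦R-◃ Sign.- (suc n) = refl

    ℤ↦R-signAbs : ∀ i → ℤ↦R i ≈ signed (ℤ.sign i) (ℕ↦R ℤ.∣ i ∣)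
    ℤ↦R-signAbs -[1+ n ] = refl
    ℤ↦R-signAbs (+ zero) = refl
    ℤ↦R-signAbs (+ suc n) = refl

  ℤ↦R-* : ∀ i j → ℤ↦R (i ℤ.* j) ≈ ℤ↦R i * ℤ↦R j
  ℤ↦R-* i j = begin
    ℤ↦R (i ℤ.* j)                                  ≈⟨ ℤ↦R-◃ (s Sign.* t) (ℤ.∣ i ∣ ℕ.* ℤ.∣ j ∣) ⟩
    signed (s Sign.* t) (ℕ↦R (ℤ.∣ i ∣ ℕ.* ℤ.∣ j ∣))  ≈⟨ signed-cong (s Sign.* t) (ℕ↦R-* ℤ.∣ i ∣ ℤ.∣ j ∣) ⟩
    signed (s Sign.* t) (ℕ↦R ℤ.∣ i ∣ * ℕ↦R ℤ.∣ j ∣)  ≈⟨ signed-* s t _ _ ⟩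
    signed s (ℕ↦R ℤ.∣ i ∣) * signed t (ℕ↦R ℤ.∣ j ∣)  ≈⟨ *-cong (ℤ↦R-signAbs i) (ℤ↦R-signAbs j) ⟨
    ℤ↦R i * ℤ↦R j                                  ∎
    where s = ℤ.sign i; t = ℤ.sign j

  ℤ↦R-homomorphism : ℤ.+-*-rawRing -Raw-AlmostCommutative⟶ fromCommutativeRing R
  ℤ↦R-homomorphism = record
    { ⟦_⟧ = ℤ↦R ; +-homo = ℤ↦R-+ ; *-homo = ℤ↦R-* ; -‿homo = ℤ↦R-neg ; 0-homo = refl ; 1-homo = refl }

  private
    ℤ↦R-≟ : ∀ i j → Maybe (ℤ↦R i ≈ ℤ↦R j)
    ℤ↦R-≟ i j with i ℤ.≟ j
    ... | yes ≡.refl = just refl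
    ... | no _ = nothing

  open import Algebra.Solver.Ring ℤ.+-*-rawRing (fromCommutativeRing R) ℤ↦R-homomorphism ℤ↦R-≟ public

  :0 :1 :2 : ∀ {n} → Polynomial n
  :0 = con (+ 0)
  :1 = con (+ 1)
  :2 = con (+ 2)

module GeneralPathHomology {c ℓ} (F : Field c ℓ) {m : ℕ} (Arr : Fin m → Fin m → Set) where
  open Field F hiding (zero)
  open PathHomology F m Arr
  open IntegerCoefficientSolver commutativeRing using (solve; _:=_; _:+_; _:*_; :-_; :0; :1)
  open import Algebra.Properties.Ring ring using (-0#≈0#; -‿distribʳ-*; -‿involutive)
  open import Relation.Binary.Reasoning.Setoid setoid

  sumFin-cong : ∀ {k} {f g : Fin k → Carrier} → (∀ i → f i ≈ g i) → sumFin f ≈ sumFin g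
  sumFin-cong {zero} e = refl
  sumFin-cong {suc k} e = +-cong (e fz) (sumFin-cong (λ i → e (fs i)))

  sumFin-zero : ∀ {k} {f : Fin k → Carrier} → (∀ i → f i ≈ 0#) → sumFin f ≈ 0#
  sumFin-zero {zero} e = refl
  sumFin-zero {suc k} e = trans (+-cong (e fz) (sumFin-zero (λ i → e (fs i)))) (+-identityˡ 0#)

  sumFin-+ : ∀ {k} (f g : Fin k → Carrier) → sumFin (λ i → f i + g i) ≈ sumFin f + sumFin g
  sumFin-+ {zero} f g = sym (+-identityˡ 0#)
  sumFin-+ {suc k} f g = trans (+-congˡ (sumFin-+ (λ i → f (fs i)) (λ i → g (fs i))))
    (solve 4 (λ a b x y → (a :+ b) :+ (x :+ y) := (a :+ x) :+ (b :+ y)) refl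
      (f fz) (g fz) (sumFin (λ i → f (fs i))) (sumFin (λ i → g (fs i))))

  sumFin-* : ∀ {k} a (f : Fin k → Carrier) → sumFin (λ i → a * f i) ≈ a * sumFin f
  sumFin-* {zero} a f = sym (zeroʳ a)
  sumFin-* {suc k} a f = trans (+-congˡ (sumFin-* a (λ i → f (fs i)))) (sym (distribˡ a _ _))

  sumFin-neg : ∀ {k} (f : Fin k → Carrier) → sumFin (λ i → - f i) ≈ - sumFin f
  sumFin-neg {zero} f = sym -0#≈0#
  sumFin-neg {suc k} f = trans (+-congˡ (sumFin-neg (λ i → f (fs i))))
    (solve 2 (λ a b → :- a :+ :- b := :- (a :+ b)) refl (f fz) (sumFin (λ i → f (fs i))))

  δ : ∀ {k} → Fin k → Fin k → Carrier
  δ x y = if does (x ≟ y) then 1# else 0#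

  δ-≢ : ∀ {k} {x y : Fin k} → x ≢ y → δ x y ≈ 0#
  δ-≢ {x = x} {y} x≢y with x ≟ y
  ... | yes x≡y = contradiction x≡y x≢y
  ... | no _ = refl

  δ-diag : ∀ {k} (x : Fin k) → δ x x ≈ 1#
  δ-diag x with x ≟ x
  ... | yes _ = refl
  ... | no x≢x = contradiction ≡.refl x≢x

  sumFin-δ : ∀ {k} (w : Fin k) (f : Fin k → Carrier) → sumFin (λ v → δ w v * f v) ≈ f w
  sumFin-δ fz f = trans (+-cong (*-identityˡ (f fz)) (sumFin-zero (λ v → zeroˡ (f (fs v))))) (+-identityʳ (f fz))
  sumFin-δ (fs w) f = trans (+-cong (zeroˡ (f fz)) (sumFin-δ w (λ v → f (fs v)))) (+-identityˡ (f (fs w)))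

  sign-cong : ∀ j {x y} → x ≈ y → sign j x ≈ sign j y
  sign-cong zero e = e
  sign-cong (suc zero) e = -‿cong e
  sign-cong (suc (suc j)) e = sign-cong j e

  sign-suc : ∀ j x → sign (suc j) x ≈ - sign j x
  sign-suc zero x = refl
  sign-suc (suc zero) x = sym (-‿involutive x)
  sign-suc (suc (suc j)) x = sign-suc j x

  sign-0# : ∀ j → sign j 0# ≈ 0#
  sign-0# zero = refl
  sign-0# (suc zero) = -0#≈0#
  sign-0# (suc (suc j)) = sign-0# j

  sign-* : ∀ j k x → sign j (k * x) ≈ k * sign j x
  sign-* zero k x = refl
  sign-* (suc zero) k x = -‿distribʳ-* k x
  sign-* (suc (suc j)) k x = sign-* j k x

  ∂ᵘ : ∀ {k} → (Path (suc k) → Carrier) → Path k → Carrier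
  ∂ᵘ u q = sumFin (λ j → sign (toℕ j) (sumFin (λ v → u (insertAt q j v))))

  ∂ᵘ-cong : ∀ {k} {u w : Path (suc k) → Carrier} → (∀ p → u p ≈ w p) → ∀ q → ∂ᵘ u q ≈ ∂ᵘ w q
  ∂ᵘ-cong e q = sumFin-cong (λ j → sign-cong (toℕ j) (sumFin-cong (λ v → e (insertAt q j v))))

  ∂ᵘ-zero : ∀ {k} {u : Path (suc k) → Carrier} → (∀ p → u p ≈ 0#) → ∀ q → ∂ᵘ u q ≈ 0#
  ∂ᵘ-zero {k} e q = trans (∂ᵘ-cong e q)
    (sumFin-zero {suc k} (λ j → trans (sign-cong (toℕ j) (sumFin-zero {m} (λ _ → refl))) (sign-0# (toℕ j))))

  ∂ᵘ-* : ∀ {k} a (u : Path (suc k) → Carrier) q → ∂ᵘ (λ p → a * u p) q ≈ a * ∂ᵘ u q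
  ∂ᵘ-* {k} a u q = begin
    ∂ᵘ (λ p → a * u p) q
      ≈⟨ sumFin-cong {suc k} (λ j → sign-cong (toℕ j) (sumFin-* a (λ v → u (insertAt q j v)))) ⟩
    sumFin (λ j → sign (toℕ j) (a * sumFin (λ v → u (insertAt q j v))))
      ≈⟨ sumFin-cong {suc k} (λ j → sign-* (toℕ j) a (sumFin (λ v → u (insertAt q j v)))) ⟩
    sumFin (λ j → a * sign (toℕ j) (sumFin (λ v → u (insertAt q j v))))
      ≈⟨ sumFin-* {suc k} a (λ j → sign (toℕ j) (sumFin (λ v → u (insertAt q j v)))) ⟩
    a * ∂ᵘ u q ∎

  ∂ᵘ-∷ : ∀ {k} u w (t : Path k) →
         ∂ᵘ u (w ∷ t) ≈ sumFin (λ v → u (v ∷ w ∷ t)) - ∂ᵘ (λ p → u (w ∷ p)) t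
  ∂ᵘ-∷ {k} u w t = +-congˡ (begin
    sumFin (λ i → sign (suc (toℕ i)) (sumFin (λ v → u (w ∷ insertAt t i v))))
      ≈⟨ sumFin-cong {suc k} (λ i → sign-suc (toℕ i) (sumFin (λ v → u (w ∷ insertAt t i v)))) ⟩
    sumFin (λ i → - sign (toℕ i) (sumFin (λ v → u (w ∷ insertAt t i v))))
      ≈⟨ sumFin-neg {suc k} (λ i → sign (toℕ i) (sumFin (λ v → u (w ∷ insertAt t i v)))) ⟩
    - ∂ᵘ (λ p → u (w ∷ p)) t ∎)

  infix 4 _≈ᶜ_
  _≈ᶜ_ : ∀ {n} → Chain n → Chain n → Set ℓ
  u ≈ᶜ w = ∀ p → u p ≈ w p

  _·ᶜ_ : ∀ {n} → Carrier → Chain n → Chain n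
  (a ·ᶜ u) p = a * u p

  ∂-regular : ∀ n (u : Chain (suc n)) q → regular? q ≡ true → ∂ n u q ≈ ∂ᵘ u q
  ∂-regular n u q reg rewrite reg = refl

  ∂-by-regularity : ∀ n (u : Chain (suc n)) q {x} →
                    (regular? q ≡ true → ∂ᵘ u q ≈ x) → (regular? q ≡ false → 0# ≈ x) → ∂ n u q ≈ x
  ∂-by-regularity n u q on-regular on-irregular with regular? q
  ... | true = on-regular ≡.refl
  ... | false = on-irregular ≡.refl

  ∂-cong : ∀ n {u w : Chain (suc n)} → u ≈ᶜ w → ∂ n u ≈ᶜ ∂ n w
  ∂-cong n e q with regular? q
  ... | true = ∂ᵘ-cong e q
  ... | false = refl

  ∂-zero : ∀ n {u : Chain (suc n)} → u ≈ᶜ (λ _ → 0#) → ∂ n u ≈ᶜ (λ _ → 0#)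
  ∂-zero n e q with regular? q
  ... | true = ∂ᵘ-zero e q
  ... | false = refl

  ∂-· : ∀ n a (u : Chain (suc n)) → ∂ n (a ·ᶜ u) ≈ᶜ a ·ᶜ ∂ n u
  ∂-· n a u q with regular? q
  ... | true = ∂ᵘ-* a u q
  ... | false = sym (zeroʳ a)

  regular-tail : ∀ {k} y (q : Path (suc k)) → regular? (y ∷ q) ≡ true → regular? q ≡ true
  regular-tail y (w ∷ t) reg with does (y ≟ w)
  ... | false = reg

  regular-∷ : ∀ {k} {y w} (t : Path k) → y ≢ w → regular? (w ∷ t) ≡ true → regular? (y ∷ w ∷ t) ≡ true
  regular-∷ {y = y} {w} t y≢w reg with y ≟ w
  ... | yes y≡w = contradiction y≡w y≢w
  ... | no _ = reg

  ∂-∷ : ∀ n (u : Chain (suc (suc n))) y q → regular? (y ∷ q) ≡ true →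
        ∂ (suc n) u (y ∷ q) ≈ sumFin (λ v → u (v ∷ y ∷ q)) - ∂ n (λ p → u (y ∷ p)) q
  ∂-∷ n u y q reg = begin
    ∂ (suc n) u (y ∷ q)                                       ≈⟨ ∂-regular (suc n) u (y ∷ q) reg ⟩
    ∂ᵘ u (y ∷ q)                                              ≈⟨ ∂ᵘ-∷ u y q ⟩
    sumFin (λ v → u (v ∷ y ∷ q)) - ∂ᵘ (λ p → u (y ∷ p)) q
      ≈⟨ +-congˡ (-‿cong (∂-regular n (λ p → u (y ∷ p)) q (regular-tail y q reg))) ⟨
    sumFin (λ v → u (v ∷ y ∷ q)) - ∂ n (λ p → u (y ∷ p)) q    ∎

  ∂-vertex : ∀ (u : Chain 1) y →
             ∂ 0 u (y ∷ []) ≈ sumFin (λ v → u (v ∷ y ∷ [])) - sumFin (λ v → u (y ∷ v ∷ []))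
  ∂-vertex u y = trans (∂ᵘ-∷ u y []) (+-congˡ (-‿cong (+-identityʳ _)))

  minuend≈0 : ∀ {a b c} → a ≈ b - c → a ≈ 0# → c ≈ 0# → b ≈ 0#
  minuend≈0 {a} {b} {c} a≈b-c a≈0 c≈0 = begin
    b            ≈⟨ solve 2 (λ b c → b := (b :+ :- c) :+ c) refl b c ⟩
    (b - c) + c  ≈⟨ +-cong (trans (sym a≈b-c) a≈0) c≈0 ⟩
    0# + 0#      ≈⟨ +-identityˡ 0# ⟩
    0#           ∎

  subtrahend≈0 : ∀ {a b c} → a ≈ b - c → a ≈ 0# → b ≈ 0# → c ≈ 0#
  subtrahend≈0 {a} {b} {c} a≈b-c a≈0 b≈0 = begin
    c              ≈⟨ solve 2 (λ b c → c := b :+ :- (b :+ :- c)) refl b c ⟩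
    b - (b - c)    ≈⟨ +-cong b≈0 (-‿cong (trans (sym a≈b-c) a≈0)) ⟩
    0# - 0#        ≈⟨ -‿inverseʳ 0# ⟩
    0#             ∎

  -- ∂z vanishes on the non-allowed path y ∷ w ∷ t, and these are its only terms that need not vanish.
  Ω-middle-sum : ∀ n z → InΩ (suc (suc n)) z → ∀ y w (t : Path n) → ¬ Arr y w →
                 regular? (y ∷ w ∷ t) ≡ true → sumFin (λ v → z (y ∷ v ∷ w ∷ t)) ≈ 0#
  Ω-middle-sum n z (zA , z∂) y w t ¬y→w reg = minuend≈0
    (begin
      ∂ n zy (w ∷ t)                                                  ≈⟨ ∂-regular n zy (w ∷ t) (regular-tail y (w ∷ t) reg) ⟩
      ∂ᵘ zy (w ∷ t)                                                   ≈⟨ ∂ᵘ-∷ zy w t ⟩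
      sumFin (λ v → z (y ∷ v ∷ w ∷ t)) - ∂ᵘ (λ p → z (y ∷ w ∷ p)) t   ∎)
    (subtrahend≈0 (∂-∷ n z y (w ∷ t) reg)
      (z∂ (y ∷ w ∷ t) (λ al → ¬y→w (proj₁ al)))
      (sumFin-zero (λ v → zA (v ∷ y ∷ w ∷ t) (λ al → ¬y→w (proj₁ (proj₂ al))))))
    (∂ᵘ-zero (λ p → zA (y ∷ w ∷ p) (λ al → ¬y→w (proj₁ al))) t)
    where
    zy : Chain (suc n)
    zy p = z (y ∷ p)

  module _ (asym : ∀ x y → Arr x y → ¬ Arr y x) where

    irregular-¬Allowed : ∀ {k} x (q : Path k) → regular? (x ∷ q) ≡ false → ¬ Allowed (x ∷ q)
    irregular-¬Allowed x (y ∷ r) irreg (x→y , al) with x ≟ y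
    ... | yes ≡.refl = asym x x x→y x→y
    ... | no _ = irregular-¬Allowed y r irreg al

    -- A face of z ∘ (y ∷_) is a face of z, unless it starts at y again; then asymmetry kills every term.
    Ω-tail : ∀ n z → InΩ (suc (suc n)) z → ∀ y → InΩ (suc n) (λ p → z (y ∷ p))
    Ω-tail n z (zA , z∂) y = zyA , zy∂
      where
      zy : Chain (suc n)
      zy p = z (y ∷ p)

      zyA : InA (suc n) zy
      zyA (x ∷ r) na = zA (y ∷ x ∷ r) (λ al → na (proj₂ al))

      zy∂ : InA n (∂ n zy)
      zy∂ (w ∷ t) na = ∂-by-regularity n zy (w ∷ t) (λ reg → case y ≟ w of λ where
        (no y≢w) → trans (sym (∂-regular n zy (w ∷ t) reg))
          (subtrahend≈0 (∂-∷ n z y (w ∷ t) (regular-∷ t y≢w reg))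
            (z∂ (y ∷ w ∷ t) (λ al → na (proj₂ al)))
            (sumFin-zero (λ v → zA (v ∷ y ∷ w ∷ t) (λ al → na (proj₂ (proj₂ al))))))
        (yes ≡.refl) → begin
          ∂ᵘ zy (y ∷ t)                                                   ≈⟨ ∂ᵘ-∷ zy y t ⟩
          sumFin (λ v → z (y ∷ v ∷ y ∷ t)) - ∂ᵘ (λ p → z (y ∷ y ∷ p)) t
            ≈⟨ +-cong (sumFin-zero (λ v → zA (y ∷ v ∷ y ∷ t) (λ al → asym y v (proj₁ al) (proj₁ (proj₂ al)))))
                      (-‿cong (∂ᵘ-zero (λ p → zA (y ∷ y ∷ p) (λ al → asym y y (proj₁ al) (proj₁ al))) t)) ⟩
          0# - 0#                                                         ≈⟨ -‿inverseʳ 0# ⟩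
          0#                                                              ∎)
        (λ _ → refl)

  InA-· : ∀ n a {u : Chain n} → InA n u → InA n (a ·ᶜ u)
  InA-· n a uA p na = trans (*-congˡ (uA p na)) (zeroʳ a)

  IsCycle-· : ∀ n a {u : Chain n} → IsCycle n u → IsCycle n (a ·ᶜ u)
  IsCycle-· zero a (uA , _) = InA-· zero a uA , tt
  IsCycle-· (suc n) a {u} ((uA , ∂uA) , ∂u≈0) =
    (InA-· (suc n) a uA , (λ q na → trans (∂-· n a u q) (InA-· n a ∂uA q na))) ,
    (λ q → trans (∂-· n a u q) (trans (*-congˡ (∂u≈0 q)) (zeroʳ a)))

  record HomologyCoordinate (n : ℕ) : Set (c ⊔ ℓ) where
    field
      φ       : Chain n → Carrier
      φ-cong  : ∀ {u w} → u ≈ᶜ w → φ u ≈ φ w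
      φ-+     : ∀ u w → φ (λ p → u p + w p) ≈ φ u + φ w
      φ-·     : ∀ a u → φ (a ·ᶜ u) ≈ a * φ u
      φ-∂     : ∀ b → InΩ (suc n) b → φ (∂ n b) ≈ 0#
      γ       : Cycle n
      φ-γ     : φ (proj₁ γ) ≈ 1#
      γ-spans : ∀ (z : Cycle n) → Homologous n (φ (proj₁ z) ·ᶜ proj₁ γ) (proj₁ z)

  homologyIsoK : ∀ {n} → HomologyCoordinate n → HomologyIsoK n
  homologyIsoK {n} H = record
    { to        = λ z → φ (proj₁ z)
    ; from      = λ a → a ·ᶜ proj₁ γ , IsCycle-· n a (proj₂ γ)
    ; to-cong   = λ { (z , _) (w , _) (b , bΩ , ∂b≈z-w) → begin
        φ z                              ≈⟨ φ-cong (λ p → z≈w+∂b (z p) (w p) (∂b≈z-w p)) ⟩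
        φ (λ p → w p + ∂ n b p)          ≈⟨ φ-+ w (∂ n b) ⟩
        φ w + φ (∂ n b)                  ≈⟨ +-congˡ (φ-∂ b bΩ) ⟩
        φ w + 0#                         ≈⟨ +-identityʳ (φ w) ⟩
        φ w                              ∎ }
    ; from-cong = λ x y x≈y → (λ _ → 0#) , ((λ _ _ → refl) , (λ q _ → ∂-zero n (λ _ → refl) q)) ,
                    (λ q → trans (∂-zero n (λ _ → refl) q)
                      (sym (trans (+-congʳ (*-congʳ x≈y)) (-‿inverseʳ (y * proj₁ γ q)))))
    ; to-+      = λ z w s s≈z+w → trans (φ-cong s≈z+w) (φ-+ (proj₁ z) (proj₁ w))
    ; to-*      = λ a z s s≈az → trans (φ-cong s≈az) (φ-· a (proj₁ z))
    ; to-from   = λ a → trans (φ-· a (proj₁ γ)) (trans (*-congˡ φ-γ) (*-identityʳ a))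
    ; from-to   = γ-spans
    }
    where
    open HomologyCoordinate H
    z≈w+∂b : ∀ z w {d} → d ≈ z - w → z ≈ w + d
    z≈w+∂b z w d≈z-w = trans (solve 2 (λ z w → z := w :+ (z :+ :- w)) refl z w) (+-congˡ (sym d≈z-w))

infixl 10 _⁺ _⁻

_⁺ : Fin 5 → Fin 5
_⁺ = succ5

_⁻ : Fin 5 → Fin 5
fz ⁻ = fs (fs (fs (fs fz)))
fs x ⁻ = inject₁ x

arr? : ∀ x y → Dec (ArrC5 x y)
arr? x y = (y ≟ x ⁺) ⊎-dec (y ≟ x ⁺ ⁺)

x⁺⁻≡x : ∀ x → x ⁺ ⁻ ≡ x
x⁺⁻≡x = from-yes (all? λ x → x ⁺ ⁻ ≟ x)

x≢x⁺ : ∀ x → x ≢ x ⁺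
x≢x⁺ = from-yes (all? λ x → ¬? (x ≟ x ⁺))

x≢x⁺⁺⁺ : ∀ x → x ≢ x ⁺ ⁺ ⁺
x≢x⁺⁺⁺ = from-yes (all? λ x → ¬? (x ≟ x ⁺ ⁺ ⁺))

x≢x⁺⁺⁺⁺ : ∀ x → x ≢ x ⁺ ⁺ ⁺ ⁺
x≢x⁺⁺⁺⁺ = from-yes (all? λ x → ¬? (x ≟ x ⁺ ⁺ ⁺ ⁺))

¬x→x⁺⁺⁺ : ∀ x → ¬ ArrC5 x (x ⁺ ⁺ ⁺)
¬x→x⁺⁺⁺ = from-yes (all? λ x → ¬? (arr? x (x ⁺ ⁺ ⁺)))

¬x→x⁺⁺⁺⁺ : ∀ x → ¬ ArrC5 x (x ⁺ ⁺ ⁺ ⁺)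
¬x→x⁺⁺⁺⁺ = from-yes (all? λ x → ¬? (arr? x (x ⁺ ⁺ ⁺ ⁺)))

x⁺⁺⁻⁻≡x : ∀ x → x ⁺ ⁺ ⁻ ⁻ ≡ x
x⁺⁺⁻⁻≡x = from-yes (all? λ x → x ⁺ ⁺ ⁻ ⁻ ≟ x)

x⁺⁻⁻≢x : ∀ x → x ⁺ ⁻ ⁻ ≢ x
x⁺⁻⁻≢x = from-yes (all? λ x → ¬? (x ⁺ ⁻ ⁻ ≟ x))

x⁺⁺⁻≢x : ∀ x → x ⁺ ⁺ ⁻ ≢ x
x⁺⁺⁻≢x = from-yes (all? λ x → ¬? (x ⁺ ⁺ ⁻ ≟ x))

x⁻≡y⇒y→x : ∀ y x → x ⁻ ≡ y → ArrC5 y x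
x⁻≡y⇒y→x = from-yes (all? λ y → all? λ x → (x ⁻ ≟ y) →-dec arr? y x)

x⁻⁻≡y⇒y→x : ∀ y x → x ⁻ ⁻ ≡ y → ArrC5 y x
x⁻⁻≡y⇒y→x = from-yes (all? λ y → all? λ x → (x ⁻ ⁻ ≟ y) →-dec arr? y x)

ArrC5-asym : ∀ x y → ArrC5 x y → ¬ ArrC5 y x
ArrC5-asym x y x→y y→x = from-yes (all? λ x → all? λ y → ¬? (arr? x y ×-dec arr? y x)) x y (x→y , y→x)

data Step (y : Fin 5) : Fin 5 → Set where
  by-1 : Step y (y ⁺)
  by-2 : Step y (y ⁺ ⁺)
  no-arrow : ∀ {x} → ¬ ArrC5 y x → Step y x

step : ∀ y x → Step y x
step y x with x ≟ y ⁺ | x ≟ y ⁺ ⁺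
... | yes ≡.refl | _ = by-1
... | no _ | yes ≡.refl = by-2
... | no x≢y⁺ | no x≢y⁺⁺ = no-arrow [ x≢y⁺ , x≢y⁺⁺ ]′

module C5 {c ℓ} (F : Field c ℓ) where
  open Field F hiding (zero)
  open PathHomology F 5 ArrC5
  open GeneralPathHomology F ArrC5
  open IntegerCoefficientSolver commutativeRing using (solve; _:=_; _:+_; _:*_; :-_; _:-_; :0; :1; :2)
  open import Algebra.Properties.Ring ring using (-0#≈0#; -‿distribˡ-*; -‿distribʳ-*)
  open import Relation.Binary.Reasoning.Setoid setoid

  -- α p = 1 on runs of +1 steps; β p = (-1)^j on runs of +1 steps with one +2 step after j of them.
  -- The test δ (y ⁻) x for a +1 step x → y is phrased through predecessors so that the boundary
  -- computation only meets the atoms δ (z ⁻) y, δ (z ⁻ ⁻) y, δ (z ⁻ ⁻ ⁻) y.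
  α : ∀ {k} → Path (suc k) → Carrier
  α (x ∷ []) = 1#
  α (x ∷ y ∷ r) = δ (y ⁻) x * α (y ∷ r)

  β : ∀ {k} → Path (suc k) → Carrier
  β (x ∷ []) = 0#
  β (x ∷ y ∷ r) = δ (y ⁻ ⁻) x * α (y ∷ r) - δ (y ⁻) x * β (y ∷ r)

  ω : ∀ {n} → (Fin 5 → Carrier) → (Fin 5 → Carrier) → Chain n
  ω a b (x ∷ r) = a x * α (x ∷ r) + b x * β (x ∷ r)

  δ-≡ : ∀ {x y : Fin 5} → x ≡ y → δ x y ≈ 1#
  δ-≡ {x} ≡.refl = δ-diag x

  private
    1*x-0*y : ∀ {d₁ d₂} x y → d₁ ≈ 1# → d₂ ≈ 0# → d₁ * x - d₂ * y ≈ x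
    1*x-0*y x y d₁≈1 d₂≈0 = trans (+-cong (*-congʳ d₁≈1) (-‿cong (*-congʳ d₂≈0)))
      (solve 2 (λ x y → :1 :* x :+ :- (:0 :* y) := x) refl x y)

    0*x-1*y : ∀ {d₁ d₂} x y → d₁ ≈ 0# → d₂ ≈ 1# → d₁ * x - d₂ * y ≈ - y
    0*x-1*y x y d₁≈0 d₂≈1 = trans (+-cong (*-congʳ d₁≈0) (-‿cong (*-congʳ d₂≈1)))
      (solve 2 (λ x y → :0 :* x :+ :- (:1 :* y) := :- y) refl x y)

    0*x-0*y : ∀ {d₁ d₂} x y → d₁ ≈ 0# → d₂ ≈ 0# → d₁ * x - d₂ * y ≈ 0#
    0*x-0*y x y d₁≈0 d₂≈0 = trans (+-cong (*-congʳ d₁≈0) (-‿cong (*-congʳ d₂≈0)))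
      (solve 2 (λ x y → :0 :* x :+ :- (:0 :* y) := :0) refl x y)

  αβ-by-1 : ∀ {k} y (r : Path k) → α (y ∷ y ⁺ ∷ r) ≈ α (y ⁺ ∷ r) × β (y ∷ y ⁺ ∷ r) ≈ - β (y ⁺ ∷ r)
  αβ-by-1 y r = trans (*-congʳ δ₁≈1) (*-identityˡ _) , 0*x-1*y (α (y ⁺ ∷ r)) (β (y ⁺ ∷ r)) δ₂≈0 δ₁≈1
    where
    δ₁≈1 = δ-≡ (x⁺⁻≡x y)
    δ₂≈0 = δ-≢ (x⁺⁻⁻≢x y)

  αβ-by-2 : ∀ {k} y (r : Path k) → α (y ∷ y ⁺ ⁺ ∷ r) ≈ 0# × β (y ∷ y ⁺ ⁺ ∷ r) ≈ α (y ⁺ ⁺ ∷ r)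
  αβ-by-2 y r = trans (*-congʳ δ₁≈0) (zeroˡ _) , 1*x-0*y (α (y ⁺ ⁺ ∷ r)) (β (y ⁺ ⁺ ∷ r)) δ₂≈1 δ₁≈0
    where
    δ₁≈0 = δ-≢ (x⁺⁺⁻≢x y)
    δ₂≈1 = δ-≡ (x⁺⁺⁻⁻≡x y)

  αβ-no-arrow : ∀ {k} {y x} (r : Path k) → ¬ ArrC5 y x → α (y ∷ x ∷ r) ≈ 0# × β (y ∷ x ∷ r) ≈ 0#
  αβ-no-arrow {y = y} {x} r ¬y→x = trans (*-congʳ δ₁≈0) (zeroˡ _) , 0*x-0*y (α (x ∷ r)) (β (x ∷ r)) δ₂≈0 δ₁≈0
    where
    δ₁≈0 = δ-≢ (λ e → ¬y→x (x⁻≡y⇒y→x y x e))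
    δ₂≈0 = δ-≢ (λ e → ¬y→x (x⁻⁻≡y⇒y→x y x e))

  ω-by-1 : ∀ {k} a b y (r : Path k) → ω a b (y ∷ y ⁺ ∷ r) ≈ a y * α (y ⁺ ∷ r) - b y * β (y ⁺ ∷ r)
  ω-by-1 a b y r = let (α≈ , β≈) = αβ-by-1 y r in
    trans (+-cong (*-congˡ α≈) (*-congˡ β≈)) (+-congˡ (sym (-‿distribʳ-* (b y) (β (y ⁺ ∷ r)))))

  ω-by-2 : ∀ {k} a b y (r : Path k) → ω a b (y ∷ y ⁺ ⁺ ∷ r) ≈ b y * α (y ⁺ ⁺ ∷ r)
  ω-by-2 a b y r = let (α≈ , β≈) = αβ-by-2 y r in
    trans (+-cong (trans (*-congˡ α≈) (zeroʳ (a y))) (*-congˡ β≈)) (+-identityˡ _)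

  ω-no-arrow : ∀ {k} a b {y x} (r : Path k) → ¬ ArrC5 y x → ω a b (y ∷ x ∷ r) ≈ 0#
  ω-no-arrow a b {y} r ¬y→x = let (α≈ , β≈) = αβ-no-arrow r ¬y→x in
    trans (+-cong (trans (*-congˡ α≈) (zeroʳ (a y))) (trans (*-congˡ β≈) (zeroʳ (b y)))) (+-identityˡ 0#)

  αβ-¬Allowed : ∀ {k} (p : Path (suc k)) → ¬ Allowed p → α p ≈ 0# × β p ≈ 0#
  αβ-¬Allowed (x ∷ []) na = contradiction tt na
  αβ-¬Allowed (x ∷ y ∷ r) na with arr? x y
  ... | no ¬x→y = αβ-no-arrow r ¬x→y
  ... | yes x→y = let (α≈0 , β≈0) = αβ-¬Allowed (y ∷ r) (λ al → na (x→y , al)) in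
    trans (*-congˡ α≈0) (zeroʳ _) ,
    trans (+-cong (trans (*-congˡ α≈0) (zeroʳ _)) (-‿cong (trans (*-congˡ β≈0) (zeroʳ _))))
      (trans (+-identityˡ _) -0#≈0#)

  ω-InA : ∀ n a b → InA n (ω a b)
  ω-InA n a b (x ∷ r) na = let (α≈0 , β≈0) = αβ-¬Allowed (x ∷ r) na in
    trans (+-cong (trans (*-congˡ α≈0) (zeroʳ (a x))) (trans (*-congˡ β≈0) (zeroʳ (b x)))) (+-identityˡ 0#)

  αtail : ∀ n → Fin 5 → Path n
  αtail zero x = []
  αtail (suc n) x = x ⁺ ∷ αtail n (x ⁺)

  αpath : ∀ n → Fin 5 → Path (suc n)
  αpath n x = x ∷ αtail n x

  βpath : ∀ n → Fin 5 → Path (suc (suc n))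
  βpath n x = x ∷ αpath n (x ⁺ ⁺)

  αpath-regular : ∀ n x → regular? (αpath n x) ≡ true
  αpath-regular zero x = ≡.refl
  αpath-regular (suc n) x = regular-∷ (αtail n (x ⁺)) (x≢x⁺ x) (αpath-regular n (x ⁺))

  αβ-αpath : ∀ n x → α (αpath n x) ≈ 1# × β (αpath n x) ≈ 0#
  αβ-αpath zero x = refl , refl
  αβ-αpath (suc n) x = let (α≈ , β≈) = αβ-by-1 x (αtail n (x ⁺)); (α≈1 , β≈0) = αβ-αpath n (x ⁺) in
    trans α≈ α≈1 , trans β≈ (trans (-‿cong β≈0) -0#≈0#)

  ω-αpath : ∀ n a b x → ω a b (αpath n x) ≈ a x
  ω-αpath n a b x = let (α≈1 , β≈0) = αβ-αpath n x in
    trans (+-cong (trans (*-congˡ α≈1) (*-identityʳ (a x))) (trans (*-congˡ β≈0) (zeroʳ (b x)))) (+-identityʳ (a x))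

  ω-βpath : ∀ n a b x → ω a b (βpath n x) ≈ b x
  ω-βpath n a b x = trans (ω-by-2 a b x (αtail n (x ⁺ ⁺)))
    (trans (*-congˡ (proj₁ (αβ-αpath n (x ⁺ ⁺)))) (*-identityʳ (b x)))

  successors-sum : ∀ y (f : Fin 5 → Carrier) → (∀ x → ¬ ArrC5 y x → f x ≈ 0#) →
                   sumFin f ≈ f (y ⁺) + f (y ⁺ ⁺)
  successors-sum y f f≈0 = begin
    sumFin f                                                          ≈⟨ sumFin-cong f≈δ ⟩
    sumFin (λ x → δ (y ⁺) x * f (y ⁺) + δ (y ⁺ ⁺) x * f (y ⁺ ⁺))
      ≈⟨ sumFin-+ (λ x → δ (y ⁺) x * f (y ⁺)) (λ x → δ (y ⁺ ⁺) x * f (y ⁺ ⁺)) ⟩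
    sumFin (λ x → δ (y ⁺) x * f (y ⁺)) + sumFin (λ x → δ (y ⁺ ⁺) x * f (y ⁺ ⁺))
      ≈⟨ +-cong (sumFin-δ (y ⁺) (λ _ → f (y ⁺))) (sumFin-δ (y ⁺ ⁺) (λ _ → f (y ⁺ ⁺))) ⟩
    f (y ⁺) + f (y ⁺ ⁺)                                               ∎
    where
    f≈δ : ∀ x → f x ≈ δ (y ⁺) x * f (y ⁺) + δ (y ⁺ ⁺) x * f (y ⁺ ⁺)
    f≈δ x with step y x
    ... | by-1 = sym (trans (+-cong (*-congʳ (δ-diag (y ⁺))) (*-congʳ (δ-≢ (≢-sym (x≢x⁺ (y ⁺))))))
                     (solve 2 (λ a b → :1 :* a :+ :0 :* b := a) refl (f (y ⁺)) (f (y ⁺ ⁺))))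
    ... | by-2 = sym (trans (+-cong (*-congʳ (δ-≢ (x≢x⁺ (y ⁺)))) (*-congʳ (δ-diag (y ⁺ ⁺))))
                     (solve 2 (λ a b → :0 :* a :+ :1 :* b := b) refl (f (y ⁺)) (f (y ⁺ ⁺))))
    ... | no-arrow ¬y→x = trans (f≈0 x ¬y→x)
          (sym (trans (+-cong (*-congʳ (δ-≢ (λ e → ¬y→x (inj₁ (≡.sym e)))))
                              (*-congʳ (δ-≢ (λ e → ¬y→x (inj₂ (≡.sym e))))))
                 (solve 2 (λ a b → :0 :* a :+ :0 :* b := :0) refl (f (y ⁺)) (f (y ⁺ ⁺)))))

  ω-predecessors-sum : ∀ {k} a b y (r : Path k) →
    sumFin (λ v → ω a b (v ∷ y ∷ r)) ≈ (a (y ⁻) * α (y ∷ r) - b (y ⁻) * β (y ∷ r)) + b (y ⁻ ⁻) * α (y ∷ r)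
  ω-predecessors-sum a b y r = begin
    sumFin (λ v → ω a b (v ∷ y ∷ r))                  ≈⟨ sumFin-cong regroup ⟩
    sumFin (λ v → δ (y ⁻) v * f v + δ (y ⁻ ⁻) v * g v)  ≈⟨ sumFin-+ (λ v → δ (y ⁻) v * f v) (λ v → δ (y ⁻ ⁻) v * g v) ⟩
    sumFin (λ v → δ (y ⁻) v * f v) + sumFin (λ v → δ (y ⁻ ⁻) v * g v)
                                                      ≈⟨ +-cong (sumFin-δ (y ⁻) f) (sumFin-δ (y ⁻ ⁻) g) ⟩
    f (y ⁻) + g (y ⁻ ⁻)                               ∎
    where
    f g : Fin 5 → Carrier
    f v = a v * α (y ∷ r) - b v * β (y ∷ r)
    g v = b v * α (y ∷ r)
    regroup : ∀ v → ω a b (v ∷ y ∷ r) ≈ δ (y ⁻) v * f v + δ (y ⁻ ⁻) v * g v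
    regroup v = solve 6 (λ av bv d₁ d₂ A B → av :* (d₁ :* A) :+ bv :* (d₂ :* A :+ :- (d₁ :* B))
                                            := d₁ :* (av :* A :+ :- (bv :* B)) :+ d₂ :* (bv :* A))
                  refl (a v) (b v) (δ (y ⁻) v) (δ (y ⁻ ⁻) v) (α (y ∷ r)) (β (y ∷ r))

  tailα tailβ : (Fin 5 → Carrier) → (Fin 5 → Carrier) → Fin 5 → Fin 5 → Carrier
  tailα a b y w = a y * δ (w ⁻) y + b y * δ (w ⁻ ⁻) y
  tailβ a b y w = - (b y * δ (w ⁻) y)

  ω-tail : ∀ {k} a b y (p : Path (suc k)) → ω a b (y ∷ p) ≈ ω (tailα a b y) (tailβ a b y) p
  ω-tail a b y (w ∷ r) =
    solve 6 (λ ay by d₁ d₂ A B → ay :* (d₁ :* A) :+ by :* (d₂ :* A :+ :- (d₁ :* B))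
                              := (ay :* d₁ :+ by :* d₂) :* A :+ :- (by :* d₁) :* B)
      refl (a y) (b y) (δ (w ⁻) y) (δ (w ⁻ ⁻) y) (α (w ∷ r)) (β (w ∷ r))

  ∂α ∂β : Carrier → (Fin 5 → Carrier) → (Fin 5 → Carrier) → Fin 5 → Carrier
  ∂α s a b x = a (x ⁻) + s * a x + b (x ⁻ ⁻) - b x
  ∂β s a b x = - a x - b (x ⁻) + s * b x

  sgn : ℕ → Carrier
  sgn zero = - 1#
  sgn (suc n) = - sgn n

  -- The inductive step of ∂-ω once unfolded, with dᵢ standing for δ (z ⁻ ⋯ ⁻) y (i predecessors).
  ∂-ω-step-identity : ∀ s ay by ay₁ by₁ by₂ d₁ d₂ d₃ A B →
    ((ay₁ * (d₁ * A) - by₁ * (d₂ * A - d₁ * B)) + by₂ * (d₁ * A))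
    - ((((ay * d₂ + by * d₃) + s * (ay * d₁ + by * d₂)) + - (by * d₃) - - (by * d₁)) * A
       + ((- (ay * d₁ + by * d₂) - - (by * d₂)) + s * - (by * d₁)) * B)
    ≈ (((ay₁ + - s * ay) + by₂) - by) * (d₁ * A) + ((- ay - by₁) + - s * by) * (d₂ * A - d₁ * B)
  ∂-ω-step-identity = solve 11 (λ s ay by ay₁ by₁ by₂ d₁ d₂ d₃ A B →
    ((ay₁ :* (d₁ :* A) :- by₁ :* (d₂ :* A :- d₁ :* B)) :+ by₂ :* (d₁ :* A))
    :- ((((ay :* d₂ :+ by :* d₃) :+ s :* (ay :* d₁ :+ by :* d₂)) :+ :- (by :* d₃) :- :- (by :* d₁)) :* A
       :+ ((:- (ay :* d₁ :+ by :* d₂) :- :- (by :* d₂)) :+ s :* :- (by :* d₁)) :* B)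
    := (((ay₁ :+ :- s :* ay) :+ by₂) :- by) :* (d₁ :* A) :+ ((:- ay :- by₁) :+ :- s :* by) :* (d₂ :* A :- d₁ :* B))
    refl

  ∂-ω : ∀ n a b → ∂ n (ω a b) ≈ᶜ ω (∂α (sgn n) a b) (∂β (sgn n) a b)
  ∂-ω zero a b (y ∷ []) = begin
    ∂ 0 (ω a b) (y ∷ [])
      ≈⟨ ∂-vertex (ω a b) y ⟩
    sumFin (λ v → ω a b (v ∷ y ∷ [])) - sumFin (λ v → ω a b (y ∷ v ∷ []))
      ≈⟨ +-cong (ω-predecessors-sum a b y [])
                (-‿cong (successors-sum y (λ v → ω a b (y ∷ v ∷ [])) (λ _ → ω-no-arrow a b []))) ⟩
    ((a (y ⁻) * 1# - b (y ⁻) * 0#) + b (y ⁻ ⁻) * 1#) - (ω a b (y ∷ y ⁺ ∷ []) + ω a b (y ∷ y ⁺ ⁺ ∷ []))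
      ≈⟨ +-congˡ (-‿cong (+-cong (ω-by-1 a b y []) (ω-by-2 a b y []))) ⟩
    ((a (y ⁻) * 1# - b (y ⁻) * 0#) + b (y ⁻ ⁻) * 1#) - ((a y * 1# - b y * 0#) + b y * 1#)
      ≈⟨ solve 5 (λ ay by ay₁ by₁ by₂ →
           ((ay₁ :* :1 :- by₁ :* :0) :+ by₂ :* :1) :- ((ay :* :1 :- by :* :0) :+ by :* :1)
           := (((ay₁ :+ :- :1 :* ay) :+ by₂) :- by) :* :1 :+ ((:- ay :- by₁) :+ :- :1 :* by) :* :0)
           refl (a y) (b y) (a (y ⁻)) (b (y ⁻)) (b (y ⁻ ⁻)) ⟩
    ω (∂α (sgn 0) a b) (∂β (sgn 0) a b) (y ∷ [])
      ∎
  ∂-ω (suc n) a b (y ∷ z ∷ r) = ∂-by-regularity (suc n) (ω a b) (y ∷ z ∷ r)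
    (λ reg → begin
      ∂ᵘ (ω a b) (y ∷ z ∷ r)
        ≈⟨ ∂ᵘ-∷ (ω a b) y (z ∷ r) ⟩
      Σpred - ∂ᵘ (λ p → ω a b (y ∷ p)) (z ∷ r)
        ≈⟨ +-congˡ (-‿cong (∂-regular n (λ p → ω a b (y ∷ p)) (z ∷ r) (regular-tail y (z ∷ r) reg))) ⟨
      Σpred - ∂ n (λ p → ω a b (y ∷ p)) (z ∷ r)
        ≈⟨ +-congˡ (-‿cong (∂-cong n (ω-tail a b y) (z ∷ r))) ⟩
      Σpred - ∂ n (ω a′ b′) (z ∷ r)
        ≈⟨ +-congˡ (-‿cong (∂-ω n a′ b′ (z ∷ r))) ⟩
      Σpred - ω (∂α (sgn n) a′ b′) (∂β (sgn n) a′ b′) (z ∷ r)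
        ≈⟨ +-congʳ (ω-predecessors-sum a b y (z ∷ r)) ⟩
      ((a (y ⁻) * α (y ∷ z ∷ r) - b (y ⁻) * β (y ∷ z ∷ r)) + b (y ⁻ ⁻) * α (y ∷ z ∷ r))
        - ω (∂α (sgn n) a′ b′) (∂β (sgn n) a′ b′) (z ∷ r)
        ≈⟨ ∂-ω-step-identity (sgn n) (a y) (b y) (a (y ⁻)) (b (y ⁻)) (b (y ⁻ ⁻))
             (δ (z ⁻) y) (δ (z ⁻ ⁻) y) (δ (z ⁻ ⁻ ⁻) y) (α (z ∷ r)) (β (z ∷ r)) ⟩
      ω (∂α (sgn (suc n)) a b) (∂β (sgn (suc n)) a b) (y ∷ z ∷ r)
        ∎)
    (λ irreg → sym (ω-InA (suc n) (∂α (sgn (suc n)) a b) (∂β (sgn (suc n)) a b) (y ∷ z ∷ r)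
                      (irregular-¬Allowed ArrC5-asym y (z ∷ r) irreg)))
    where
    a′ b′ : Fin 5 → Carrier
    a′ = tailα a b y
    b′ = tailβ a b y
    Σpred : Carrier
    Σpred = sumFin (λ v → ω a b (v ∷ y ∷ z ∷ r))

  Ω-two-paths : ∀ n z → InΩ (suc (suc n)) z → ∀ y w (t : Path n) → ¬ ArrC5 y w → y ≢ w →
                regular? (w ∷ t) ≡ true → z (y ∷ y ⁺ ∷ w ∷ t) + z (y ∷ y ⁺ ⁺ ∷ w ∷ t) ≈ 0#
  Ω-two-paths n z Ωz@(zA , _) y w t ¬y→w y≢w reg = begin
    z (y ∷ y ⁺ ∷ w ∷ t) + z (y ∷ y ⁺ ⁺ ∷ w ∷ t)
      ≈⟨ successors-sum y (λ v → z (y ∷ v ∷ w ∷ t)) (λ v ¬y→v → zA (y ∷ v ∷ w ∷ t) (λ al → ¬y→v (proj₁ al))) ⟨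
    sumFin (λ v → z (y ∷ v ∷ w ∷ t))
      ≈⟨ Ω-middle-sum n z Ωz y w t ¬y→w (regular-∷ t y≢w reg) ⟩
    0# ∎

  Ω-βpath-by-1 : ∀ n z → InΩ (suc (suc n)) z → ∀ y → z (y ∷ βpath n (y ⁺)) ≈ - z (βpath (suc n) y)
  Ω-βpath-by-1 n z Ωz y = begin
    a              ≈⟨ solve 2 (λ a b → a := (a :+ b) :- b) refl a b ⟩
    (a + b) - b    ≈⟨ +-congʳ (Ω-two-paths n z Ωz y (y ⁺ ⁺ ⁺) (αtail n (y ⁺ ⁺ ⁺))
                                (¬x→x⁺⁺⁺ y) (x≢x⁺⁺⁺ y) (αpath-regular n (y ⁺ ⁺ ⁺))) ⟩
    0# - b         ≈⟨ +-identityˡ (- b) ⟩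
    - b            ∎
    where
    a b : Carrier
    a = z (y ∷ βpath n (y ⁺))
    b = z (βpath (suc n) y)

  Ω-βpath-by-2 : ∀ n z → InΩ (suc (suc n)) z → ∀ y → z (y ∷ βpath n (y ⁺ ⁺)) ≈ 0#
  Ω-βpath-by-2 n z Ωz@(zA , _) y = begin
    z (y ∷ βpath n (y ⁺ ⁺))                            ≈⟨ +-identityˡ _ ⟨
    0# + z (y ∷ βpath n (y ⁺ ⁺))                       ≈⟨ +-congʳ (zA (y ∷ y ⁺ ∷ αpath n (y ⁺ ⁺ ⁺ ⁺))
                                                                    (λ al → ¬x→x⁺⁺⁺ (y ⁺) (proj₁ (proj₂ al)))) ⟨
    z (y ∷ y ⁺ ∷ αpath n (y ⁺ ⁺ ⁺ ⁺)) + z (y ∷ βpath n (y ⁺ ⁺))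
      ≈⟨ Ω-two-paths n z Ωz y (y ⁺ ⁺ ⁺ ⁺) (αtail n (y ⁺ ⁺ ⁺ ⁺))
                     (¬x→x⁺⁺⁺⁺ y) (x≢x⁺⁺⁺⁺ y) (αpath-regular n (y ⁺ ⁺ ⁺ ⁺)) ⟩
    0#                                                 ∎

  αpart βpart : ∀ n → Chain (suc n) → Fin 5 → Carrier
  αpart n z x = z (αpath (suc n) x)
  βpart n z x = z (βpath n x)

  Ω-expansion : ∀ n z → InΩ (suc n) z → z ≈ᶜ ω (αpart n z) (βpart n z)
  Ω-expansion zero z (zA , _) (y ∷ x ∷ []) with step y x
  ... | by-1 = sym (trans (ω-by-1 a b y [])
                  (solve 2 (λ a b → a :* :1 :- b :* :0 := a) refl (a y) (b y)))
    where a = αpart 0 z; b = βpart 0 z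
  ... | by-2 = sym (trans (ω-by-2 a b y []) (*-identityʳ (b y)))
    where a = αpart 0 z; b = βpart 0 z
  ... | no-arrow ¬y→x = trans (zA (y ∷ x ∷ []) (λ al → ¬y→x (proj₁ al)))
                          (sym (ω-no-arrow (αpart 0 z) (βpart 0 z) [] ¬y→x))
  Ω-expansion (suc n) z Ωz@(zA , _) (y ∷ x ∷ r) with step y x
  ... | by-1 = begin
    z (y ∷ y ⁺ ∷ r)                   ≈⟨ Ω-expansion n zy (Ω-tail ArrC5-asym n z Ωz y) (y ⁺ ∷ r) ⟩
    a y * α (y ⁺ ∷ r) + zy (βpath n (y ⁺)) * β (y ⁺ ∷ r)
                                      ≈⟨ +-congˡ (*-congʳ (Ω-βpath-by-1 n z Ωz y)) ⟩
    a y * α (y ⁺ ∷ r) + - b y * β (y ⁺ ∷ r)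
                                      ≈⟨ +-congˡ (-‿distribˡ-* (b y) (β (y ⁺ ∷ r))) ⟨
    a y * α (y ⁺ ∷ r) - b y * β (y ⁺ ∷ r)
                                      ≈⟨ ω-by-1 a b y r ⟨
    ω a b (y ∷ y ⁺ ∷ r)               ∎
    where a = αpart (suc n) z; b = βpart (suc n) z; zy = λ p → z (y ∷ p)
  ... | by-2 = begin
    z (y ∷ y ⁺ ⁺ ∷ r)                 ≈⟨ Ω-expansion n zy (Ω-tail ArrC5-asym n z Ωz y) (y ⁺ ⁺ ∷ r) ⟩
    b y * α (y ⁺ ⁺ ∷ r) + zy (βpath n (y ⁺ ⁺)) * β (y ⁺ ⁺ ∷ r)
                                      ≈⟨ +-congˡ (trans (*-congʳ (Ω-βpath-by-2 n z Ωz y)) (zeroˡ _)) ⟩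
    b y * α (y ⁺ ⁺ ∷ r) + 0#          ≈⟨ +-identityʳ _ ⟩
    b y * α (y ⁺ ⁺ ∷ r)               ≈⟨ ω-by-2 a b y r ⟨
    ω a b (y ∷ y ⁺ ⁺ ∷ r)             ∎
    where a = αpart (suc n) z; b = βpart (suc n) z; zy = λ p → z (y ∷ p)
  ... | no-arrow ¬y→x = trans (zA (y ∷ x ∷ r) (λ al → ¬y→x (proj₁ al)))
                          (sym (ω-no-arrow (αpart (suc n) z) (βpart (suc n) z) r ¬y→x))

  ω-cong : ∀ {n} {a a′ b b′ : Fin 5 → Carrier} → (∀ x → a x ≈ a′ x) → (∀ x → b x ≈ b′ x) →
           ω {n} a b ≈ᶜ ω a′ b′
  ω-cong a≈ b≈ (x ∷ r) = +-cong (*-congʳ (a≈ x)) (*-congʳ (b≈ x))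

  ω-InΩ : ∀ n a b → InΩ (suc n) (ω a b)
  ω-InΩ n a b = ω-InA (suc n) a b , λ p na → trans (∂-ω n a b p) (ω-InA n _ _ p na)

  ∂-Ω : ∀ n z → InΩ (suc n) z →
        ∂ n z ≈ᶜ ω (∂α (sgn n) (αpart n z) (βpart n z)) (∂β (sgn n) (αpart n z) (βpart n z))
  ∂-Ω n z Ωz p = trans (∂-cong n (Ω-expansion n z Ωz) p) (∂-ω n (αpart n z) (βpart n z) p)

  sumFin-⁻ : ∀ (f : Fin 5 → Carrier) → sumFin (λ x → f (x ⁻)) ≈ sumFin f
  sumFin-⁻ f = solve 5 (λ f₀ f₁ f₂ f₃ f₄ → f₄ :+ (f₀ :+ (f₁ :+ (f₂ :+ (f₃ :+ :0))))
                                         := f₀ :+ (f₁ :+ (f₂ :+ (f₃ :+ (f₄ :+ :0)))))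
                  refl (f fz) (f (fs fz)) (f (fs (fs fz))) (f (fs (fs (fs fz)))) (f (fs (fs (fs (fs fz)))))

  sumFin-∂α : ∀ s a b → sumFin (∂α s a b) ≈ (1# + s) * sumFin a
  sumFin-∂α s a b = begin
    sumFin (∂α s a b)
      ≈⟨ sumFin-+ (λ x → a (x ⁻) + s * a x + b (x ⁻ ⁻)) (λ x → - b x) ⟩
    sumFin (λ x → a (x ⁻) + s * a x + b (x ⁻ ⁻)) + sumFin (λ x → - b x)
      ≈⟨ +-cong (trans (sumFin-+ (λ x → a (x ⁻) + s * a x) (λ x → b (x ⁻ ⁻)))
                       (+-cong (sumFin-+ (λ x → a (x ⁻)) (λ x → s * a x))
                               (trans (sumFin-⁻ (λ x → b (x ⁻))) (sumFin-⁻ b))))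
                (sumFin-neg b) ⟩
    (sumFin (λ x → a (x ⁻)) + sumFin (λ x → s * a x)) + sumFin b - sumFin b
      ≈⟨ +-congʳ (+-congʳ (+-cong (sumFin-⁻ a) (sumFin-* s a))) ⟩
    (sumFin a + s * sumFin a) + sumFin b - sumFin b
      ≈⟨ solve 3 (λ s A B → (A :+ s :* A) :+ B :- B := (:1 :+ s) :* A) refl s (sumFin a) (sumFin b) ⟩
    (1# + s) * sumFin a
      ∎

  sumFin-∂β : ∀ s a b → sumFin (∂β s a b) ≈ (s - 1#) * sumFin b - sumFin a
  sumFin-∂β s a b = begin
    sumFin (∂β s a b)
      ≈⟨ sumFin-+ (λ x → - a x - b (x ⁻)) (λ x → s * b x) ⟩
    sumFin (λ x → - a x - b (x ⁻)) + sumFin (λ x → s * b x)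
      ≈⟨ +-cong (trans (sumFin-+ (λ x → - a x) (λ x → - b (x ⁻)))
                       (+-cong (sumFin-neg a) (trans (sumFin-neg (λ x → b (x ⁻))) (-‿cong (sumFin-⁻ b)))))
                (sumFin-* s b) ⟩
    (- sumFin a - sumFin b) + s * sumFin b
      ≈⟨ solve 3 (λ s A B → (:- A :- B) :+ s :* B := (s :- :1) :* B :- A) refl s (sumFin a) (sumFin b) ⟩
    (s - 1#) * sumFin b - sumFin a
      ∎

  higher-homology-trivial : ∀ m → HomologyTrivial (suc (suc m))
  higher-homology-trivial m (z , Ωz , ∂z≈0) = ω (λ x → - b x) (λ _ → 0#) , ω-InΩ (suc (suc m)) _ _ , ∂w≈z
    where
    s = sgn (suc m)
    a = αpart (suc m) z
    b = βpart (suc m) z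

    ∂β≈0 : ∀ x → ∂β s a b x ≈ 0#
    ∂β≈0 x = begin
      ∂β s a b x                          ≈⟨ ω-βpath m (∂α s a b) (∂β s a b) x ⟨
      ω (∂α s a b) (∂β s a b) (βpath m x) ≈⟨ ∂-Ω (suc m) z Ωz (βpath m x) ⟨
      ∂ (suc m) z (βpath m x)             ≈⟨ ∂z≈0 (βpath m x) ⟩
      0#                                  ∎

    ∂α≈a : ∀ x → ∂α (- s) (λ x → - b x) (λ _ → 0#) x ≈ a x
    ∂α≈a x = begin
      ∂α (- s) (λ x → - b x) (λ _ → 0#) x
        ≈⟨ solve 4 (λ s a b b₁ → ((:- b₁ :+ :- s :* :- b) :+ :0) :- :0
                               := a :+ ((:- a :- b₁) :+ s :* b)) refl s (a x) (b x) (b (x ⁻)) ⟩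
      a x + ∂β s a b x                    ≈⟨ +-congˡ (∂β≈0 x) ⟩
      a x + 0#                            ≈⟨ +-identityʳ (a x) ⟩
      a x                                 ∎

    ∂β≈b : ∀ x → ∂β (- s) (λ x → - b x) (λ _ → 0#) x ≈ b x
    ∂β≈b x = solve 2 (λ s b → (:- :- b :- :0) :+ :- s :* :0 := b) refl s (b x)

    ∂w≈z : ∀ p → ∂ (suc (suc m)) (ω (λ x → - b x) (λ _ → 0#)) p ≈ z p - 0#
    ∂w≈z p = begin
      ∂ (suc (suc m)) (ω (λ x → - b x) (λ _ → 0#)) p
        ≈⟨ ∂-ω (suc (suc m)) (λ x → - b x) (λ _ → 0#) p ⟩
      ω (∂α (- s) (λ x → - b x) (λ _ → 0#)) (∂β (- s) (λ x → - b x) (λ _ → 0#)) p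
        ≈⟨ ω-cong ∂α≈a ∂β≈b p ⟩
      ω a b p                             ≈⟨ Ω-expansion (suc m) z Ωz p ⟨
      z p                                 ≈⟨ trans (+-congˡ -0#≈0#) (+-identityʳ (z p)) ⟨
      z p - 0#                            ∎

  InA-0 : ∀ (u : Chain 0) → InA 0 u
  InA-0 u (x ∷ []) na = contradiction tt na

  ω-vertex : ∀ a b y → ω a b (y ∷ []) ≈ a y
  ω-vertex a b = ω-αpath 0 a b

  prefixSum : ∀ {k} → (Fin (suc k) → Carrier) → Fin (suc k) → Carrier
  prefixSum f fz = f fz
  prefixSum {suc k} f (fs i) = f fz + prefixSum (λ j → f (fs j)) i

  prefixSum-fs : ∀ {k} (f : Fin (suc (suc k)) → Carrier) i → prefixSum f (fs i) ≈ prefixSum f (inject₁ i) + f (fs i)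
  prefixSum-fs f fz = refl
  prefixSum-fs {suc k} f (fs i) =
    trans (+-congˡ (prefixSum-fs (λ j → f (fs j)) i)) (sym (+-assoc _ _ _))

  prefixSum-last : ∀ {k} (f : Fin (suc k) → Carrier) → prefixSum f (fromℕ k) ≈ sumFin f
  prefixSum-last {zero} f = sym (+-identityʳ (f fz))
  prefixSum-last {suc k} f = +-congˡ (prefixSum-last (λ j → f (fs j)))

  -- the +1 arrows telescope the prefix sums: ∂ (ω (prefixSum f) 0) = (Σ f) · [0] - f
  prefixSum-pr : ∀ (f : Fin 5 → Carrier) y → prefixSum f (y ⁻) - prefixSum f y ≈ δ fz y * sumFin f - f y
  prefixSum-pr f fz = +-cong (trans (prefixSum-last f) (sym (*-identityˡ (sumFin f)))) refl
  prefixSum-pr f (fs i) = begin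
    prefixSum f (inject₁ i) - prefixSum f (fs i)          ≈⟨ +-congˡ (-‿cong (prefixSum-fs f i)) ⟩
    prefixSum f (inject₁ i) - (prefixSum f (inject₁ i) + f (fs i))
      ≈⟨ solve 3 (λ P S x → P :- (P :+ x) := :0 :* S :- x) refl (prefixSum f (inject₁ i)) (sumFin f) (f (fs i)) ⟩
    0# * sumFin f - f (fs i)                              ∎

  H₀-coordinate : HomologyCoordinate 0
  H₀-coordinate = record
    { φ       = φ
    ; φ-cong  = λ e → sumFin-cong (λ x → e (x ∷ []))
    ; φ-+     = λ u w → sumFin-+ (λ x → u (x ∷ [])) (λ x → w (x ∷ []))
    ; φ-·     = λ a u → sumFin-* a (λ x → u (x ∷ []))
    ; φ-∂     = φ-∂
    ; γ       = γ , InA-0 γ , tt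
    ; φ-γ     = trans (sumFin-cong {5} (λ x → sym (*-identityʳ (δ fz x)))) (sumFin-δ {5} fz (λ _ → 1#))
    ; γ-spans = γ-spans
    }
    where
    φ : Chain 0 → Carrier
    φ z = sumFin (λ x → z (x ∷ []))

    γ : Chain 0
    γ (x ∷ []) = δ fz x

    φ-∂ : ∀ b → InΩ 1 b → φ (∂ 0 b) ≈ 0#
    φ-∂ b Ωb = begin
      φ (∂ 0 b)
        ≈⟨ sumFin-cong {5} (λ y → trans (∂-Ω 0 b Ωb (y ∷ [])) (ω-vertex (∂α (- 1#) a d) (∂β (- 1#) a d) y)) ⟩
      sumFin (∂α (- 1#) a d)             ≈⟨ sumFin-∂α (- 1#) a d ⟩
      (1# + - 1#) * sumFin a             ≈⟨ trans (*-congʳ (-‿inverseʳ 1#)) (zeroˡ (sumFin a)) ⟩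
      0#                                 ∎
      where
      a = αpart 0 b
      d = βpart 0 b

    γ-spans : ∀ (z : Cycle 0) → Homologous 0 (φ (proj₁ z) ·ᶜ γ) (proj₁ z)
    γ-spans (z , _) = ω e (λ _ → 0#) , ω-InΩ 0 e (λ _ → 0#) , ∂w≈ 
      where
      f : Fin 5 → Carrier
      f x = z (x ∷ [])
      e : Fin 5 → Carrier
      e = prefixSum f
      ∂w≈ : ∀ p → ∂ 0 (ω e (λ _ → 0#)) p ≈ φ z * γ p - z p
      ∂w≈ (y ∷ []) = begin
        ∂ 0 (ω e (λ _ → 0#)) (y ∷ [])
          ≈⟨ trans (∂-ω 0 e (λ _ → 0#) (y ∷ [])) (ω-vertex (∂α (- 1#) e (λ _ → 0#)) (∂β (- 1#) e (λ _ → 0#)) y) ⟩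
        ∂α (- 1#) e (λ _ → 0#) y                  ≈⟨ solve 2 (λ c₁ c → ((c₁ :+ :- :1 :* c) :+ :0) :- :0 := c₁ :- c)
                                                       refl (e (y ⁻)) (e y) ⟩
        e (y ⁻) - e y                             ≈⟨ prefixSum-pr f y ⟩
        δ fz y * sumFin f - f y                   ≈⟨ +-congʳ (*-comm (δ fz y) (sumFin f)) ⟩
        φ z * δ fz y - z (y ∷ [])                 ∎

  ω-·- : ∀ {n} k a b a′ b′ → ω {n} (λ x → k * a x - a′ x) (λ x → k * b x - b′ x) ≈ᶜ (λ p → k * ω a b p - ω a′ b′ p)
  ω-·- k a b a′ b′ (x ∷ r) =
    solve 7 (λ k a b a′ b′ A B → (k :* a :- a′) :* A :+ (k :* b :- b′) :* B := k :* (a :* A :+ b :* B) :- (a′ :* A :+ b′ :* B))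
      refl k (a x) (b x) (a′ x) (b′ x) (α (x ∷ r)) (β (x ∷ r))

  -- Weighting +1 arrows by 1 and +2 arrows by 2 measures how often a 1-chain winds around ℤ/5.
  winding : Chain 1 → Carrier
  winding u = sumFin (λ x → u (x ∷ x ⁺ ∷ []) + (1# + 1#) * u (x ∷ x ⁺ ⁺ ∷ []))

  winding-cong : ∀ {u w} → u ≈ᶜ w → winding u ≈ winding w
  winding-cong e = sumFin-cong (λ x → +-cong (e (x ∷ x ⁺ ∷ [])) (*-congˡ {1# + 1#} (e (x ∷ x ⁺ ⁺ ∷ []))))

  winding-+ : ∀ u w → winding (λ p → u p + w p) ≈ winding u + winding w
  winding-+ u w = trans
    (sumFin-cong (λ x → solve 4 (λ u₁ u₂ w₁ w₂ → (u₁ :+ w₁) :+ :2 :* (u₂ :+ w₂)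
                                              := (u₁ :+ :2 :* u₂) :+ (w₁ :+ :2 :* w₂))
                          refl (u (x ∷ x ⁺ ∷ [])) (u (x ∷ x ⁺ ⁺ ∷ [])) (w (x ∷ x ⁺ ∷ [])) (w (x ∷ x ⁺ ⁺ ∷ []))))
    (sumFin-+ (λ x → u (x ∷ x ⁺ ∷ []) + (1# + 1#) * u (x ∷ x ⁺ ⁺ ∷ []))
              (λ x → w (x ∷ x ⁺ ∷ []) + (1# + 1#) * w (x ∷ x ⁺ ⁺ ∷ [])))

  winding-· : ∀ k u → winding (k ·ᶜ u) ≈ k * winding u
  winding-· k u = trans
    (sumFin-cong (λ x → solve 3 (λ k u₁ u₂ → k :* u₁ :+ :2 :* (k :* u₂)
                                          := k :* (u₁ :+ :2 :* u₂))
                          refl k (u (x ∷ x ⁺ ∷ [])) (u (x ∷ x ⁺ ⁺ ∷ []))))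
    (sumFin-* k (λ x → u (x ∷ x ⁺ ∷ []) + (1# + 1#) * u (x ∷ x ⁺ ⁺ ∷ [])))

  winding-ω : ∀ a b → winding (ω a b) ≈ sumFin (λ x → a x + (1# + 1#) * b x)
  winding-ω a b = sumFin-cong (λ x → +-cong (ω-αpath 1 a b x) (*-congˡ {1# + 1#} (ω-βpath 0 a b x)))

  winding-∂ : ∀ s a b → winding (ω (∂α s a b) (∂β s a b)) ≈ (s - 1#) * (sumFin a + (1# + 1#) * sumFin b)
  winding-∂ s a b = begin
    winding (ω (∂α s a b) (∂β s a b))
      ≈⟨ winding-ω (∂α s a b) (∂β s a b) ⟩
    sumFin (λ x → ∂α s a b x + (1# + 1#) * ∂β s a b x)
      ≈⟨ sumFin-+ (∂α s a b) (λ x → (1# + 1#) * ∂β s a b x) ⟩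
    sumFin (∂α s a b) + sumFin (λ x → (1# + 1#) * ∂β s a b x)
      ≈⟨ +-cong (sumFin-∂α s a b) (trans (sumFin-* (1# + 1#) (∂β s a b)) (*-congˡ (sumFin-∂β s a b))) ⟩
    (1# + s) * sumFin a + (1# + 1#) * ((s - 1#) * sumFin b - sumFin a)
      ≈⟨ solve 3 (λ s A B → (:1 :+ s) :* A :+ :2 :* ((s :- :1) :* B :- A)
                          := (s :- :1) :* (A :+ :2 :* B))
                 refl s (sumFin a) (sumFin b) ⟩
    (s - 1#) * (sumFin a + (1# + 1#) * sumFin b)
      ∎

  ⁻-invariant⇒constant : ∀ (g : Fin 5 → Carrier) → (∀ y → g (y ⁻) ≈ g y) → ∀ x → g x ≈ g fz
  ⁻-invariant⇒constant g inv fz = refl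
  ⁻-invariant⇒constant g inv (fs fz) =
    trans (inv (fs (fs fz))) (trans (inv (fs (fs (fs fz)))) (trans (inv (fs (fs (fs (fs fz))))) (inv fz)))
  ⁻-invariant⇒constant g inv (fs (fs fz)) = trans (inv (fs (fs (fs fz)))) (trans (inv (fs (fs (fs (fs fz))))) (inv fz))
  ⁻-invariant⇒constant g inv (fs (fs (fs fz))) = trans (inv (fs (fs (fs (fs fz))))) (inv fz)
  ⁻-invariant⇒constant g inv (fs (fs (fs (fs fz)))) = inv fz

  sumFin-const : ∀ a → sumFin (λ (_ : Fin 5) → a) ≈ natCast F 5 * a
  sumFin-const = solve 1 (λ a → a :+ (a :+ (a :+ (a :+ (a :+ :0)))) := (:1 :+ (:1 :+ (:1 :+ (:1 :+ (:1 :+ :0))))) :* a) refl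

  H₁-coordinate : CharZero F → HomologyCoordinate 1
  H₁-coordinate char0 = record
    { φ       = φ
    ; φ-cong  = λ e → *-congˡ (winding-cong e)
    ; φ-+     = λ u w → trans (*-congˡ (winding-+ u w)) (distribˡ ⅕ (winding u) (winding w))
    ; φ-·     = λ k u → trans (*-congˡ (winding-· k u))
                          (solve 3 (λ i k W → i :* (k :* W) := k :* (i :* W)) refl ⅕ k (winding u))
    ; φ-∂     = φ-∂
    ; γ       = γ , ω-InΩ 0 (λ _ → 1#) (λ _ → 0#) , ∂γ≈0
    ; φ-γ     = φ-γ
    ; γ-spans = γ-spans
    }
    where
    ⅕ : Carrier
    ⅕ = proj₁ (inverse (natCast F 5) (char0 4))

    5*⅕≈1 : natCast F 5 * ⅕ ≈ 1#
    5*⅕≈1 = proj₂ (inverse (natCast F 5) (char0 4))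

    φ : Chain 1 → Carrier
    φ u = ⅕ * winding u

    φ-∂ : ∀ b → InΩ 2 b → φ (∂ 1 b) ≈ 0#
    φ-∂ b Ωb = begin
      ⅕ * winding (∂ 1 b)
        ≈⟨ *-congˡ (trans (winding-cong (∂-Ω 1 b Ωb)) (winding-∂ (sgn 1) (αpart 1 b) (βpart 1 b))) ⟩
      ⅕ * ((- - 1# - 1#) * (sumFin (αpart 1 b) + (1# + 1#) * sumFin (βpart 1 b)))
        ≈⟨ solve 3 (λ i A B → i :* ((:- :- :1 :- :1) :* (A :+ :2 :* B)) := :0)
                   refl ⅕ (sumFin (αpart 1 b)) (sumFin (βpart 1 b)) ⟩
      0# ∎

    γ : Chain 1
    γ = ω (λ _ → 1#) (λ _ → 0#)

    ∂γ≈0 : ∀ q → ∂ 0 γ q ≈ 0#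
    ∂γ≈0 (y ∷ []) = begin
      ∂ 0 γ (y ∷ [])
        ≈⟨ ∂-ω 0 (λ _ → 1#) (λ _ → 0#) (y ∷ []) ⟩
      ω (∂α (- 1#) (λ _ → 1#) (λ _ → 0#)) (∂β (- 1#) (λ _ → 1#) (λ _ → 0#)) (y ∷ [])
        ≈⟨ ω-vertex (∂α (- 1#) (λ _ → 1#) (λ _ → 0#)) (∂β (- 1#) (λ _ → 1#) (λ _ → 0#)) y ⟩
      ((1# + - 1# * 1#) + 0#) - 0#
        ≈⟨ solve 0 (((:1 :+ :- :1 :* :1) :+ :0) :- :0 := :0) refl ⟩
      0# ∎

    φ-γ : φ γ ≈ 1#
    φ-γ = begin
      ⅕ * winding γ                                   ≈⟨ *-congˡ (winding-ω (λ _ → 1#) (λ _ → 0#)) ⟩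
      ⅕ * sumFin (λ (_ : Fin 5) → 1# + (1# + 1#) * 0#)
        ≈⟨ *-congˡ (sumFin-cong {5} (λ _ → trans (+-congˡ (zeroʳ (1# + 1#))) (+-identityʳ 1#))) ⟩
      ⅕ * natCast F 5                                 ≈⟨ *-comm ⅕ (natCast F 5) ⟩
      natCast F 5 * ⅕                                 ≈⟨ 5*⅕≈1 ⟩
      1#                                              ∎

    γ-spans : ∀ (z : Cycle 1) → Homologous 1 (φ (proj₁ z) ·ᶜ γ) (proj₁ z)
    γ-spans (z , Ωz , ∂z≈0) = ω b (λ _ → 0#) , ω-InΩ 1 b (λ _ → 0#) , ∂w≈
      where
      a b G : Fin 5 → Carrier
      a = αpart 0 z
      b = βpart 0 z
      G x = a x + b x + b (x ⁻)

      G-⁻ : ∀ y → G (y ⁻) ≈ G y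
      G-⁻ y = begin
        G (y ⁻)                     ≈⟨ solve 5 (λ a₁ b₁ b₂ a b → a₁ :+ b₁ :+ b₂ := (a :+ b :+ b₁) :+ (((a₁ :+ :- :1 :* a) :+ b₂) :- b))
                                             refl (a (y ⁻)) (b (y ⁻)) (b (y ⁻ ⁻)) (a y) (b y) ⟩
        G y + ∂α (- 1#) a b y       ≈⟨ +-congˡ (trans (sym (ω-vertex (∂α (- 1#) a b) (∂β (- 1#) a b) y))
                                                     (trans (sym (∂-Ω 0 z Ωz (y ∷ []))) (∂z≈0 (y ∷ [])))) ⟩
        G y + 0#                    ≈⟨ +-identityʳ (G y) ⟩
        G y                         ∎

      winding≈ΣG : winding z ≈ sumFin G
      winding≈ΣG = begin
        winding z                                   ≈⟨ sumFin-+ a (λ x → (1# + 1#) * b x) ⟩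
        sumFin a + sumFin (λ x → (1# + 1#) * b x)   ≈⟨ +-congˡ (sumFin-* (1# + 1#) b) ⟩
        sumFin a + (1# + 1#) * sumFin b
          ≈⟨ solve 2 (λ A B → A :+ :2 :* B := (A :+ B) :+ B) refl (sumFin a) (sumFin b) ⟩
        (sumFin a + sumFin b) + sumFin b            ≈⟨ +-cong (sym (sumFin-+ a b)) (sym (sumFin-⁻ b)) ⟩
        sumFin (λ x → a x + b x) + sumFin (λ x → b (x ⁻))
                                                    ≈⟨ sumFin-+ (λ x → a x + b x) (λ x → b (x ⁻)) ⟨
        sumFin G                                    ∎

      G≈φ : ∀ x → G x ≈ φ z
      G≈φ x = begin
        G x                                 ≈⟨ ⁻-invariant⇒constant G G-⁻ x ⟩
        G fz                                ≈⟨ *-identityˡ (G fz) ⟨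
        1# * G fz                           ≈⟨ *-congʳ (trans (*-comm ⅕ (natCast F 5)) 5*⅕≈1) ⟨
        (⅕ * natCast F 5) * G fz            ≈⟨ *-assoc ⅕ (natCast F 5) (G fz) ⟩
        ⅕ * (natCast F 5 * G fz)            ≈⟨ *-congˡ (sumFin-const (G fz)) ⟨
        ⅕ * sumFin {5} (λ _ → G fz)         ≈⟨ *-congˡ (sumFin-cong {5} (⁻-invariant⇒constant G G-⁻)) ⟨
        ⅕ * sumFin G                        ≈⟨ *-congˡ winding≈ΣG ⟨
        φ z                                 ∎

      ∂w≈ : ∀ p → ∂ 1 (ω b (λ _ → 0#)) p ≈ φ z * γ p - z p
      ∂w≈ p = begin
        ∂ 1 (ω b (λ _ → 0#)) p
          ≈⟨ ∂-ω 1 b (λ _ → 0#) p ⟩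
        ω (∂α (sgn 1) b (λ _ → 0#)) (∂β (sgn 1) b (λ _ → 0#)) p
          ≈⟨ ω-cong ∂α≈ ∂β≈ p ⟩
        ω (λ x → φ z * 1# - a x) (λ x → φ z * 0# - b x) p
          ≈⟨ ω-·- (φ z) (λ _ → 1#) (λ _ → 0#) a b p ⟩
        φ z * γ p - ω a b p
          ≈⟨ +-congˡ (-‿cong (Ω-expansion 0 z Ωz p)) ⟨
        φ z * γ p - z p ∎
        where
        ∂α≈ : ∀ x → ∂α (sgn 1) b (λ _ → 0#) x ≈ φ z * 1# - a x
        ∂α≈ x = trans (solve 3 (λ b₁ b a → ((b₁ :+ :- :- :1 :* b) :+ :0) :- :0
                                        := (a :+ b :+ b₁) :* :1 :- a)
                             refl (b (x ⁻)) (b x) (a x))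
                      (+-congʳ (*-congʳ (G≈φ x)))
        ∂β≈ : ∀ x → ∂β (sgn 1) b (λ _ → 0#) x ≈ φ z * 0# - b x
        ∂β≈ x = solve 2 (λ κ b → (:- b :- :0) :+ :- :- :1 :* :0 := κ :* :0 :- b)
                  refl (φ z) (b x)

theorem2p5 : ∀ {c ℓ} (F : Field c ℓ) → CharZero F →
    let open PathHomology F 5 ArrC5 in
      (HomologyIsoK 0 × HomologyIsoK 1) × (∀ (n : ℕ) → 2 ≤ n → HomologyTrivial n)
theorem2p5 F char0 =
  (homologyIsoK H₀-coordinate , homologyIsoK (H₁-coordinate char0)) , higher
  where
  open GeneralPathHomology F ArrC5 using (homologyIsoK)
  open C5 F
  open PathHomology F 5 ArrC5 using (HomologyTrivial)
  higher : ∀ n → 2 ≤ n → HomologyTrivial n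
  higher (suc (suc m)) (ℕ.s≤s (ℕ.s≤s _)) = higher-homology-trivial m
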